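{- For every admissible order $n$ (that is, every integer $n\geq 6$ such that $3$ divides $\binom{n}{2}$), there exists a $3$-star system of order $n$ which is either $(n-1)$-block-colourable or $n$-block-colourable.
   Context: A $3$-star is a copy of the complete bipartite graph $K_{1,3}$. A $3$-star system of order $n$ is a pair $(V,\mathcal{B})$ where $|V|=n$ and $\mathcal{B}$ is a set of $3$-stars (subgraphs of the complete graph $K_n$ on $V$) whose edge sets partition the edge set of $K_n$; the elements of $\mathcal B$ are called blocks. An order $n$ is admissible if a $3$-star system of order $n$ exists, which holds exactly when $n\ge 6$ and $3\mid\binom{n}{2}$. A block-colouring is a partition of $\mathcal{B}$ into colour classes such that the blocks in each colour class are pairwise vertex-disjoint. The system is $k$-block-colourable if it admits a block-colouring with $k$ colour classes. -}

module Defs where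

open import Data.Nat using (ℕ; _≤_)
open import Data.Nat.Divisibility using (_∣_)
open import Data.Nat.Combinatorics using (_C_)
open import Data.Fin using (Fin)
open import Data.Product using (Σ; ∃; ∃-syntax; _×_; ∃!)
open import Data.Sum using (_⊎_)
open import Function.Definitions using (Surjective)
open import Relation.Binary.PropositionalEquality using (_≡_)
open import Relation.Nullary using (¬_)

Admissible : ℕ → Set
Admissible n = 6 ≤ n × 3 ∣ (n C 2)

record Star (n : ℕ) : Set where
  field
    centre : Fin n
    leaf₁ leaf₂ leaf₃ : Fin n
    c≢1 : ¬ centre ≡ leaf₁
    c≢2 : ¬ centre ≡ leaf₂
    c≢3 : ¬ centre ≡ leaf₃
    1≢2 : ¬ leaf₁ ≡ leaf₂
    1≢3 : ¬ leaf₁ ≡ leaf₃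
    2≢3 : ¬ leaf₂ ≡ leaf₃

open Star public

IsLeaf : ∀ {n} → Fin n → Star n → Set
IsLeaf v s = v ≡ leaf₁ s ⊎ v ≡ leaf₂ s ⊎ v ≡ leaf₃ s

IsVertex : ∀ {n} → Fin n → Star n → Set
IsVertex v s = v ≡ centre s ⊎ IsLeaf v s

HasEdge : ∀ {n} → Star n → Fin n → Fin n → Set
HasEdge s u v = (u ≡ centre s × IsLeaf v s) ⊎ (v ≡ centre s × IsLeaf u s)

record StarSystem (n : ℕ) : Set where
  field
    m      : ℕ
    block  : Fin m → Star n
    partition : ∀ (u v : Fin n) → ¬ u ≡ v →
                ∃! _≡_ (λ i → HasEdge (block i) u v)

open StarSystem public

VertexDisjoint : ∀ {n} → Star n → Star n → Set
VertexDisjoint s t = ∀ v → ¬ (IsVertex v s × IsVertex v t)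

-- A block-colouring with k colour classes: a partition of the blocks into
-- exactly k (nonempty) classes, i.e. a surjective map to Fin k, such that
-- distinct blocks of the same colour are vertex-disjoint.
IsBlockColouring : ∀ {n} (S : StarSystem n) (k : ℕ) → (Fin (m S) → Fin k) → Set
IsBlockColouring S k col =
  Surjective _≡_ _≡_ col ×
  (∀ i j → ¬ i ≡ j → col i ≡ col j → VertexDisjoint (block S i) (block S j))

BlockColourable : ∀ {n} → StarSystem n → ℕ → Set
BlockColourable S k = ∃[ col ] IsBlockColouring S k col

-- For n ≡ 1 (mod 6) write n = 2h + 1 with h = 3r + 3 and develop r + 1 base stars over ℤₙ
-- whose centre-to-leaf differences ±d cover every d ∈ [1, h] exactly once; for n ≡ 0 (mod 6) do
-- the same over ℤₙ₋₁ with h = 3r + 2 and an extra point ∞, which replaces the one leaf whose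
-- difference 3r + 3 is too large.  The base stars are pairwise vertex-disjoint, so colouring the
-- translate by z of base star j with z − (centre of j) makes every colour class a translate of the
-- whole base configuration: n, resp. n − 1, colours.
-- For n ≡ 4, 3 (mod 6) add three new points to such a system of order n − 3.  The base stars miss
-- one residue g, so a vertex w lies in no block of colour w − g and the star joining w to the
-- three new points can join that class; three stars centred at the new points, each with leaves
-- the next new point and two fixed old vertices x₀, x₁, get three new colours.
-- Orders n ≡ 2, 5 (mod 6) are not admissible, as then 3 ∤ n(n − 1)/2.

module Submission where

open import Defs
open import Algebra.Bundles using (AbelianGroup)
open import Algebra.Core using (Op₁; Op₂)
open import Algebra.Structures using (IsAbelianGroup)
import Algebra.Properties.AbelianGroup as AbelianGroupProperties
import Algebra.Properties.CommutativeSemigroup as CommutativeSemigroupProperties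
open import Data.Empty using (⊥-elim)
open import Data.Fin as Fin using (Fin; toℕ; fromℕ; fromℕ<)
open import Data.Fin.Patterns using (0F; 1F; 2F)
open import Data.Fin.Properties
  using (toℕ-injective; toℕ<n; toℕ-fromℕ; toℕ-fromℕ<; fromℕ<-cong; +↔⊎; *↔×)
import Data.Fin.Properties as Finₚ
open import Data.Maybe using (Maybe; nothing; just)
open import Data.Nat as ℕ
  using (ℕ; zero; suc; _+_; _*_; _∸_; _≤_; _<_; _≤?_; z≤n; s≤s; s≤s⁻¹; NonZero; >-nonZero⁻¹)
open import Data.Nat.Combinatorics using (_C_; nCk+nC[k+1]≡[n+1]C[k+1]; nC1≡n)
open import Data.Nat.DivMod
  using (_%_; _/_; _mod_; m≡m%n+[m/n]*n; m%n<n; m<n⇒m%n≡m; n%n≡0; %-distribˡ-+; [m+kn]%n≡m%n)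
open import Data.Nat.Divisibility using (_∣_; ∣m+n∣m⇒∣n; n∣m*n; ∣⇒≤; ∣-trans)
open import Data.Nat.Properties
open import Data.Nat.Tactic.RingSolver using (solve-∀)
open import Data.Product using (∃-syntax; ∃!; _×_; _,_; proj₂)
open import Data.Product.Function.NonDependent.Propositional using (_×-↔_)
open import Data.Sign.Base as Sign using (Sign; opposite)
open import Data.Sign.Properties using (s≢opposite[s])
open import Data.Sum as Sum using (_⊎_; inj₁; inj₂; swap)
open import Data.Sum.Function.Propositional using (_⊎-↔_)
open import Data.Sum.Properties using (inj₁-injective; inj₂-injective)
open import Function.Base using (_∘′_)
open import Function.Bundles using (_↔_; Inverse; Injection; mk↔ₛ′)
open import Function.Consequences.Propositional using (strictlySurjective⇒surjective)
open import Function.Definitions using (Injective; Surjective; StrictlySurjective)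
open import Function.Properties.Inverse using (↔-refl; ↔-sym; ↔-trans; Inverse⇒Injection)
open import Relation.Binary.PropositionalEquality hiding ([_]; J)
open import Relation.Nullary using (¬_; yes; no)

to-injective : ∀ {A B : Set} (e : A ↔ B) → Injective _≡_ _≡_ (Inverse.to e)
to-injective e = Injection.injective (Inverse⇒Injection e)

from-injective : ∀ {A B : Set} (e : A ↔ B) → Injective _≡_ _≡_ (Inverse.from e)
from-injective e = to-injective (↔-sym e)

record Claw (V : Set) : Set where
  field
    hub            : V
    leaf           : Fin 3 → V
    hub≢leaf       : ∀ i → hub ≢ leaf i
    leaf-injective : Injective _≡_ _≡_ leaf

open Claw public

LeafOf : ∀ {V} → Claw V → V → Set
LeafOf s v = ∃[ i ] v ≡ leaf s i

VertexOf : ∀ {V} → Claw V → V → Set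
VertexOf s v = v ≡ hub s ⊎ LeafOf s v

Arc : ∀ {V} → Claw V → V → V → Set
Arc s u v = u ≡ hub s × LeafOf s v

EdgeOf : ∀ {V} → Claw V → V → V → Set
EdgeOf s u v = Arc s u v ⊎ Arc s v u

Disjoint : ∀ {V} → Claw V → Claw V → Set
Disjoint s t = ∀ v → ¬ (VertexOf s v × VertexOf t v)

disjoint-sym : ∀ {V} {s t : Claw V} → Disjoint s t → Disjoint t s
disjoint-sym d v (v∈t , v∈s) = d v (v∈s , v∈t)

module _ {V B : Set} (claw : B → Claw V)
  (arc-unique : ∀ b b′ {u v} → Arc (claw b) u v → Arc (claw b′) u v → b ≡ b′)
  (arc-asymmetric : ∀ b b′ {u v} → Arc (claw b) u v → ¬ Arc (claw b′) v u) where

  edge-unique-from-arcs : ∀ {u v} → ∃[ b ] EdgeOf (claw b) u v →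
                          ∃! _≡_ (λ b → EdgeOf (claw b) u v)
  edge-unique-from-arcs (b , e) = b , e , unique e
    where
    unique : ∀ {b b′ u v} → EdgeOf (claw b) u v → EdgeOf (claw b′) u v → b ≡ b′
    unique {b} {b′} (inj₁ a) (inj₁ a′) = arc-unique b b′ a a′
    unique {b} {b′} (inj₁ a) (inj₂ a′) = ⊥-elim (arc-asymmetric b b′ a a′)
    unique {b} {b′} (inj₂ a) (inj₁ a′) = ⊥-elim (arc-asymmetric b b′ a a′)
    unique {b} {b′} (inj₂ a) (inj₂ a′) = arc-unique b b′ a a′

record ColouredClawSystem (V : Set) : Set₁ where
  field
    Block       : Set
    claw        : Block → Claw V
    edge-unique : ∀ u v → u ≢ v → ∃! _≡_ (λ b → EdgeOf (claw b) u v)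
    Colour            : Set
    colour            : Block → Colour
    colour-surjective : StrictlySurjective _≡_ colour
    monochromatic-disjoint : ∀ b b′ → b ≢ b′ → colour b ≡ colour b′ →
                             Disjoint (claw b) (claw b′)

open ColouredClawSystem public

arc-distinct : ∀ {V} (s : Claw V) {u v} → Arc s u v → u ≢ v
arc-distinct s (refl , i , refl) = hub≢leaf s i

module _ {V} (S : ColouredClawSystem V) where

  arc-block-unique : ∀ {b b′ u v} → Arc (claw S b) u v → EdgeOf (claw S b′) u v → b ≡ b′
  arc-block-unique {b} {u = u} {v} a e =
    let (_ , _ , unique) = edge-unique S u v (arc-distinct (claw S b) a) in
    trans (sym (unique (inj₁ a))) (unique e)

  arc-unique : ∀ {b b′ u v} → Arc (claw S b) u v → Arc (claw S b′) u v → b ≡ b′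
  arc-unique a a′ = arc-block-unique a (inj₁ a′)

  arc-asymmetric : ∀ {b b′ u v} → Arc (claw S b) u v → ¬ Arc (claw S b′) v u
  arc-asymmetric {b} {b′} {u} {v} a@(u≡hub , _) a′@(v≡hub′ , _) = arc-distinct (claw S b) a (begin
    u               ≡⟨ u≡hub ⟩
    hub (claw S b)  ≡⟨ cong (hub ∘′ claw S) (arc-block-unique a (inj₂ a′)) ⟩
    hub (claw S b′) ≡⟨ v≡hub′ ⟨
    v               ∎)
    where open ≡-Reasoning

module Realise {V : Set} {n : ℕ} (ι : V ↔ Fin n) where
  open Inverse ι

  transposeˡ : ∀ {u x} → u ≡ to x → from u ≡ x
  transposeˡ {x = x} refl = strictlyInverseʳ x

  transposeʳ : ∀ {u x} → from u ≡ x → u ≡ to x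
  transposeʳ {u} refl = sym (strictlyInverseˡ u)

  star : Claw V → Star n
  star s = record
    { centre = to (hub s)
    ; leaf₁ = to (leaf s 0F) ; leaf₂ = to (leaf s 1F) ; leaf₃ = to (leaf s 2F)
    ; c≢1 = hub≢leaf s 0F ∘′ to-injective ι
    ; c≢2 = hub≢leaf s 1F ∘′ to-injective ι
    ; c≢3 = hub≢leaf s 2F ∘′ to-injective ι
    ; 1≢2 = (λ ()) ∘′ leaf-injective s ∘′ to-injective ι
    ; 1≢3 = (λ ()) ∘′ leaf-injective s ∘′ to-injective ι
    ; 2≢3 = (λ ()) ∘′ leaf-injective s ∘′ to-injective ι
    }

  leaf⁺ : ∀ s {u} → LeafOf s (from u) → IsLeaf u (star s)
  leaf⁺ s (0F , p) = inj₁ (transposeʳ p)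
  leaf⁺ s (1F , p) = inj₂ (inj₁ (transposeʳ p))
  leaf⁺ s (2F , p) = inj₂ (inj₂ (transposeʳ p))

  leaf⁻ : ∀ s {u} → IsLeaf u (star s) → LeafOf s (from u)
  leaf⁻ s (inj₁ p)        = 0F , transposeˡ p
  leaf⁻ s (inj₂ (inj₁ p)) = 1F , transposeˡ p
  leaf⁻ s (inj₂ (inj₂ p)) = 2F , transposeˡ p

  vertex⁻ : ∀ s {u} → IsVertex u (star s) → VertexOf s (from u)
  vertex⁻ s (inj₁ p) = inj₁ (transposeˡ p)
  vertex⁻ s (inj₂ p) = inj₂ (leaf⁻ s p)

  edge⁺ : ∀ s {u v} → EdgeOf s (from u) (from v) → HasEdge (star s) u v
  edge⁺ s (inj₁ (p , q)) = inj₁ (transposeʳ p , leaf⁺ s q)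
  edge⁺ s (inj₂ (p , q)) = inj₂ (transposeʳ p , leaf⁺ s q)

  edge⁻ : ∀ s {u v} → HasEdge (star s) u v → EdgeOf s (from u) (from v)
  edge⁻ s (inj₁ (p , q)) = inj₁ (transposeˡ p , leaf⁻ s q)
  edge⁻ s (inj₂ (p , q)) = inj₂ (transposeˡ p , leaf⁻ s q)

realise : ∀ {V n m k} (S : ColouredClawSystem V) →
          V ↔ Fin n → Block S ↔ Fin m → Colour S ↔ Fin k →
          ∃[ T ] BlockColourable {n} T k
realise {V} {n} {m} {k} S ι β κ = system , colouring , surjective , disjoint
  where
  open Realise ι
  module ι = Inverse ι
  module β = Inverse β
  module κ = Inverse κ

  block′ : Fin m → Star n
  block′ i = star (claw S (β.from i))

  partition′ : ∀ u v → u ≢ v → ∃! _≡_ (λ i → HasEdge (block′ i) u v)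
  partition′ u v u≢v with edge-unique S (ι.from u) (ι.from v) (u≢v ∘′ from-injective ι)
  ... | b , e , unique =
    β.to b
    , edge⁺ (claw S (β.from (β.to b)))
        (subst (λ c → EdgeOf (claw S c) (ι.from u) (ι.from v)) (sym (β.strictlyInverseʳ b)) e)
    , λ {i} e′ → trans (cong β.to (unique (edge⁻ (claw S (β.from i)) e′))) (β.strictlyInverseˡ i)

  system : StarSystem n
  system = record { m = m ; block = block′ ; partition = partition′ }

  colouring : Fin m → Fin k
  colouring i = κ.to (colour S (β.from i))

  surjective : Surjective _≡_ _≡_ colouring
  surjective = strictlySurjective⇒surjective λ c →
    let (b , p) = colour-surjective S (κ.from c) in
    β.to b , (begin
      κ.to (colour S (β.from (β.to b))) ≡⟨ cong (κ.to ∘′ colour S) (β.strictlyInverseʳ b) ⟩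
      κ.to (colour S b)                 ≡⟨ cong κ.to p ⟩
      κ.to (κ.from c)                   ≡⟨ κ.strictlyInverseˡ c ⟩
      c                                 ∎)
    where open ≡-Reasoning

  disjoint : ∀ i j → i ≢ j → colouring i ≡ colouring j → VertexDisjoint (block′ i) (block′ j)
  disjoint i j i≢j same v (vi , vj) =
    monochromatic-disjoint S (β.from i) (β.from j)
      (i≢j ∘′ from-injective β)
      (to-injective κ same)
      (ι.from v) (vertex⁻ (claw S (β.from i)) vi , vertex⁻ (claw S (β.from j)) vj)

-- Developing base stars over an abelian group

module Development {A : Set} {op : Op₂ A} {e : A} {inv : Op₁ A}
  (isAbelianGroup : IsAbelianGroup _≡_ op e inv) where

  private
    abelianGroup : AbelianGroup _ _
    abelianGroup = record { isAbelianGroup = isAbelianGroup }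

  open AbelianGroup abelianGroup using (_∙_; ε; _⁻¹; _-_; assoc; identityˡ)
  open AbelianGroupProperties abelianGroup
    using (∙-cancelˡ; ∙-cancelʳ; //-rightDividesˡ; //-rightDividesʳ; ⁻¹-anti-homo‿-;
           identityˡ-unique; inverseˡ-unique; ε⁻¹≈ε; x∙y⁻¹≈ε⇒x≈y)
  open CommutativeSemigroupProperties (AbelianGroup.commutativeSemigroup abelianGroup)
    using (x∙yz≈y∙xz)

  Reaches : ∀ {J F : Set} → (J → Fin 3 → A ⊎ F) → J → A → Set
  Reaches offset j d = d ≡ ε ⊎ ∃[ i ] offset j i ≡ inj₁ d

  record Starter (J F : Set) : Set where
    field
      base   : J → A
      offset : J → Fin 3 → A ⊎ F
      offset-covers       : ∀ d → d ≢ ε →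
                            ∃[ j ] ∃[ i ] (offset j i ≡ inj₁ d ⊎ offset j i ≡ inj₁ (d ⁻¹))
      offset-unique       : ∀ {j j′ i i′ d} → offset j i ≡ inj₁ d → offset j′ i′ ≡ inj₁ d →
                            j ≡ j′ × i ≡ i′
      offset-not-opposite : ∀ {j j′ i i′ d} → offset j i ≡ inj₁ d → offset j′ i′ ≢ inj₁ (d ⁻¹)
      fixed-covered    : ∀ f → ∃[ j ] ∃[ i ] offset j i ≡ inj₂ f
      fixed-unique     : ∀ {j j′ i i′ f f′} → offset j i ≡ inj₂ f → offset j′ i′ ≡ inj₂ f′ →
                         j ≡ j′ × i ≡ i′
      -- no translate could cover an edge between two fixed points
      fixed-irrelevant : ∀ (f f′ : F) → f ≡ f′
      base-disjoint : ∀ {j j′ d d′} → Reaches offset j d → Reaches offset j′ d′ →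
                      d ∙ base j ≡ d′ ∙ base j′ → j ≡ j′

  module Developed {J F : Set} (st : Starter J F) where
    open Starter st

    shift : A → A ⊎ F → A ⊎ F
    shift z (inj₁ d) = inj₁ (d ∙ z)
    shift z (inj₂ f) = inj₂ f

    shift-group : ∀ {z o y} → inj₁ y ≡ shift z o → ∃[ d ] o ≡ inj₁ d × y ≡ d ∙ z
    shift-group {o = inj₁ d} refl = d , refl , refl

    offset≢ε : ∀ {j i} → offset j i ≢ inj₁ ε
    offset≢ε eq = offset-not-opposite eq (trans eq (cong inj₁ (sym ε⁻¹≈ε)))

    shift-injective : ∀ {z j j′ i i′} → shift z (offset j i) ≡ shift z (offset j′ i′) →
                      j ≡ j′ × i ≡ i′
    shift-injective {z} {j} {j′} {i} {i′} p with offset j i in eq | offset j′ i′ in eq′ | p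
    ... | inj₁ d | inj₁ d′ | q =
      offset-unique eq (trans eq′ (cong inj₁ (∙-cancelʳ z d′ d (sym (inj₁-injective q)))))
    ... | inj₂ f | inj₂ f′ | _ = fixed-unique eq eq′

    developed : J × A → Claw (A ⊎ F)
    developed (j , z) = record
      { hub = inj₁ z
      ; leaf = shift z ∘′ offset j
      ; hub≢leaf = λ i p → let (d , eq , z≡dz) = shift-group p in
                     offset≢ε (trans eq (cong inj₁ (identityˡ-unique d z (sym z≡dz))))
      ; leaf-injective = proj₂ ∘′ shift-injective
      }

    developed-arc-unique : ∀ b b′ {u v} → Arc (developed b) u v → Arc (developed b′) u v → b ≡ b′
    developed-arc-unique (j , z) (j′ , z′) (refl , _ , v≡) (refl , _ , v≡′)
      with shift-injective (trans (sym v≡) v≡′)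
    ... | refl , _ = refl

    developed-arc-asymmetric : ∀ b b′ {u v} → Arc (developed b) u v → ¬ Arc (developed b′) v u
    developed-arc-asymmetric (j , z) (j′ , z′) (refl , _ , v≡) (refl , _ , u≡)
      with shift-group v≡ | shift-group u≡
    ... | d , eq , z′≡dz | d′ , eq′ , z≡d′z′ =
      offset-not-opposite eq (trans eq′ (cong inj₁ (inverseˡ-unique d′ d d′∙d≡ε)))
      where
      d′∙d≡ε : d′ ∙ d ≡ ε
      d′∙d≡ε = identityˡ-unique (d′ ∙ d) z (begin
        d′ ∙ d ∙ z   ≡⟨ assoc d′ d z ⟩
        d′ ∙ (d ∙ z) ≡⟨ cong (d′ ∙_) (sym z′≡dz) ⟩
        d′ ∙ z′      ≡⟨ sym z≡d′z′ ⟩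
        z            ∎)
        where open ≡-Reasoning

    arc-from-offset : ∀ {j i x y} → offset j i ≡ inj₁ (y - x) →
                      Arc (developed (j , x)) (inj₁ x) (inj₁ y)
    arc-from-offset {x = x} {y} eq =
      refl , _ , trans (cong inj₁ (sym (//-rightDividesˡ x y))) (cong (shift x) (sym eq))

    edge-exists : ∀ u v → u ≢ v → ∃[ b ] EdgeOf (developed b) u v
    edge-exists (inj₁ x) (inj₁ y) x≢y with offset-covers (x - y) (x≢y ∘′ cong inj₁ ∘′ x∙y⁻¹≈ε⇒x≈y x y)
    ... | j , i , inj₁ eq = (j , y) , inj₂ (arc-from-offset eq)
    ... | j , i , inj₂ eq =
      (j , x) , inj₁ (arc-from-offset (trans eq (cong inj₁ (⁻¹-anti-homo‿- x y))))
    edge-exists (inj₁ x) (inj₂ f) _ = let (j , i , eq) = fixed-covered f in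
      (j , x) , inj₁ (refl , i , cong (shift x) (sym eq))
    edge-exists (inj₂ f) (inj₁ x) _ = let (j , i , eq) = fixed-covered f in
      (j , x) , inj₂ (refl , i , cong (shift x) (sym eq))
    edge-exists (inj₂ f) (inj₂ f′) f≢f′ = ⊥-elim (f≢f′ (cong inj₂ (fixed-irrelevant f f′)))

    -- The class of colour c consists of the base stars, placed at their centres, translated by c.
    colourOf : J × A → A
    colourOf (j , z) = z - base j

    vertex-offset : ∀ {j z w} → VertexOf (developed (j , z)) (inj₁ w) →
                    ∃[ d ] Reaches offset j d × w ≡ d ∙ z
    vertex-offset {z = z} (inj₁ refl) = ε , inj₁ refl , sym (identityˡ z)
    vertex-offset (inj₂ (i , p)) =
      let (d , eq , w≡dz) = shift-group p in d , inj₂ (i , eq) , w≡dz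

    vertex-in-class : ∀ {j z w} → VertexOf (developed (j , z)) (inj₁ w) →
                      ∃[ d ] Reaches offset j d × w ≡ colourOf (j , z) ∙ (d ∙ base j)
    vertex-in-class {j} {z} {w} v = let (d , reach , w≡dz) = vertex-offset v in d , reach , (begin
      w                             ≡⟨ w≡dz ⟩
      d ∙ z                         ≡⟨ cong (d ∙_) (//-rightDividesˡ (base j) z) ⟨
      d ∙ ((z - base j) ∙ base j)   ≡⟨ x∙yz≈y∙xz d (z - base j) (base j) ⟩
      (z - base j) ∙ (d ∙ base j)   ∎)
      where open ≡-Reasoning

    shift-fixed : ∀ {z j i f} → inj₂ f ≡ shift z (offset j i) → offset j i ≡ inj₂ f
    shift-fixed {j = j} {i} p with offset j i | p
    ... | inj₂ f | refl = refl

    monochromatic-disjoint′ : ∀ b b′ → b ≢ b′ → colourOf b ≡ colourOf b′ →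
                              Disjoint (developed b) (developed b′)
    monochromatic-disjoint′ (j , z) (j′ , z′) b≢b′ same (inj₁ w) (v , v′)
      with vertex-in-class v | vertex-in-class v′
    ... | d , reach , w≡ | d′ , reach′ , w≡′
      with base-disjoint reach reach′ (∙-cancelˡ (colourOf (j , z)) _ _
             (trans (sym w≡) (trans w≡′ (cong (_∙ (d′ ∙ base j′)) (sym same)))))
    ... | refl = b≢b′ (cong (j ,_) (∙-cancelʳ (base j ⁻¹) z z′ same))
    monochromatic-disjoint′ (j , z) (j′ , z′) b≢b′ same (inj₂ f) (inj₂ (_ , p) , inj₂ (_ , p′))
      with fixed-unique (shift-fixed p) (shift-fixed p′)
    ... | refl , _ = b≢b′ (cong (j ,_) (∙-cancelʳ (base j ⁻¹) z z′ same))

    system : J → ColouredClawSystem (A ⊎ F)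
    system j₀ = record
      { Block = J × A
      ; claw = developed
      ; edge-unique = λ u v u≢v → edge-unique-from-arcs developed
          developed-arc-unique developed-arc-asymmetric (edge-exists u v u≢v)
      ; Colour = A
      ; colour = colourOf
      ; colour-surjective = λ c → (j₀ , c ∙ base j₀) , //-rightDividesʳ (base j₀) c
      ; monochromatic-disjoint = monochromatic-disjoint′
      }

    free-in-class : ∀ t → (∀ {j d} → Reaches offset j d → d ∙ base j ≢ t) →
                    ∀ {w b} → colourOf b ≡ w - t → ¬ VertexOf (developed b) (inj₁ w)
    free-in-class t unreached {w} {j , z} c≡ v with vertex-in-class v
    ... | d , reach , w≡ = unreached reach (∙-cancelˡ (w - t) _ _ (begin
      (w - t) ∙ (d ∙ base j)          ≡⟨ cong (_∙ (d ∙ base j)) c≡ ⟨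
      colourOf (j , z) ∙ (d ∙ base j) ≡⟨ w≡ ⟨
      w                               ≡⟨ //-rightDividesˡ t w ⟨
      (w - t) ∙ t                     ∎))
      where open ≡-Reasoning

-- Adding three points

lift : ∀ {V V′ : Set} {f : V → V′} → Injective _≡_ _≡_ f → Claw V → Claw V′
lift {f = f} f-injective s = record
  { hub = f (hub s)
  ; leaf = f ∘′ leaf s
  ; hub≢leaf = λ i → hub≢leaf s i ∘′ f-injective
  ; leaf-injective = leaf-injective s ∘′ f-injective
  }

lift-arc : ∀ {V V′ : Set} {f : V → V′} (f-injective : Injective _≡_ _≡_ f) (s : Claw V) {x y} →
           Arc s x y → Arc (lift f-injective s) (f x) (f y)
lift-arc {f = f} _ s (x≡hub , i , y≡leaf) = cong f x≡hub , i , cong f y≡leaf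

lift-vertex : ∀ {V V′ : Set} {f : V → V′} (f-injective : Injective _≡_ _≡_ f) (s : Claw V) {x} →
              VertexOf (lift f-injective s) (f x) → VertexOf s x
lift-vertex f-injective s (inj₁ p)       = inj₁ (f-injective p)
lift-vertex f-injective s (inj₂ (i , p)) = inj₂ (i , f-injective p)

next : Fin 3 → Fin 3
next 0F = 1F
next 1F = 2F
next 2F = 0F

next≢ : ∀ t → t ≢ next t
next≢ 0F ()
next≢ 1F ()
next≢ 2F ()

next²≢ : ∀ t → next (next t) ≢ t
next²≢ 0F ()
next²≢ 1F ()
next²≢ 2F ()

adjacent : ∀ {t t′} → t ≢ t′ → t′ ≡ next t ⊎ t ≡ next t′
adjacent {0F} {0F} t≢t′ = ⊥-elim (t≢t′ refl)
adjacent {0F} {1F} _ = inj₁ refl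
adjacent {0F} {2F} _ = inj₂ refl
adjacent {1F} {0F} _ = inj₂ refl
adjacent {1F} {1F} t≢t′ = ⊥-elim (t≢t′ refl)
adjacent {1F} {2F} _ = inj₁ refl
adjacent {2F} {0F} _ = inj₁ refl
adjacent {2F} {1F} _ = inj₂ refl
adjacent {2F} {2F} t≢t′ = ⊥-elim (t≢t′ refl)

module AddThreePoints {V : Set} (S : ColouredClawSystem V)
  (x₀ x₁ : V) (x₀≢x₁ : x₀ ≢ x₁)
  {W : Set} (ψ : W → V) (ψ-injective : Injective _≡_ _≡_ ψ)
  (ψ≢x₀ : ∀ w → ψ w ≢ x₀) (ψ≢x₁ : ∀ w → ψ w ≢ x₁)
  (covers : ∀ x → x ≡ x₀ ⊎ x ≡ x₁ ⊎ ∃[ w ] x ≡ ψ w)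
  (φ : W → Colour S) (φ-injective : Injective _≡_ _≡_ φ)
  (φ-free : ∀ {w b} → colour S b ≡ φ w → ¬ VertexOf (claw S b) (ψ w)) where

  V′ : Set
  V′ = V ⊎ Fin 3

  spoke : W → Claw V′
  spoke w = record
    { hub = inj₁ (ψ w)
    ; leaf = inj₂
    ; hub≢leaf = λ _ ()
    ; leaf-injective = inj₂-injective
    }

  triangle : Fin 3 → Claw V′
  triangle t = record
    { hub = inj₂ t
    ; leaf = leaf′
    ; hub≢leaf = hub≢leaf′
    ; leaf-injective = leaf-injective′
    }
    where
    leaf′ : Fin 3 → V′
    leaf′ 0F = inj₂ (next t)
    leaf′ 1F = inj₁ x₀
    leaf′ 2F = inj₁ x₁
    hub≢leaf′ : ∀ i → inj₂ t ≢ leaf′ i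
    hub≢leaf′ 0F = next≢ t ∘′ inj₂-injective
    hub≢leaf′ 1F ()
    hub≢leaf′ 2F ()
    leaf-injective′ : Injective _≡_ _≡_ leaf′
    leaf-injective′ {0F} {0F} _ = refl
    leaf-injective′ {1F} {1F} _ = refl
    leaf-injective′ {2F} {2F} _ = refl
    leaf-injective′ {1F} {2F} p = ⊥-elim (x₀≢x₁ (inj₁-injective p))
    leaf-injective′ {2F} {1F} p = ⊥-elim (x₀≢x₁ (inj₁-injective (sym p)))
    leaf-injective′ {0F} {1F} ()
    leaf-injective′ {0F} {2F} ()
    leaf-injective′ {1F} {0F} ()
    leaf-injective′ {2F} {0F} ()

  Block′ : Set
  Block′ = Block S ⊎ W ⊎ Fin 3

  claw′ : Block′ → Claw V′
  claw′ (inj₁ b)        = lift inj₁-injective (claw S b)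
  claw′ (inj₂ (inj₁ w)) = spoke w
  claw′ (inj₂ (inj₂ t)) = triangle t

  colour′ : Block′ → Colour S ⊎ Fin 3
  colour′ (inj₁ b)        = inj₁ (colour S b)
  colour′ (inj₂ (inj₁ w)) = inj₁ (φ w)
  colour′ (inj₂ (inj₂ t)) = inj₂ t

  old-new : ∀ x t → ∃[ b ] EdgeOf (claw′ b) (inj₁ x) (inj₂ t)
  old-new x t with covers x
  ... | inj₁ refl             = inj₂ (inj₂ t) , inj₂ (refl , 1F , refl)
  ... | inj₂ (inj₁ refl)      = inj₂ (inj₂ t) , inj₂ (refl , 2F , refl)
  ... | inj₂ (inj₂ (w , refl)) = inj₂ (inj₁ w) , inj₁ (refl , t , refl)

  edge-exists : ∀ u v → u ≢ v → ∃[ b ] EdgeOf (claw′ b) u v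
  edge-exists (inj₁ x) (inj₁ y) x≢y =
    let (b , e , _) = edge-unique S x y (x≢y ∘′ cong inj₁) in
    inj₁ b , Sum.map (lift-arc inj₁-injective (claw S b)) (lift-arc inj₁-injective (claw S b)) e
  edge-exists (inj₁ x) (inj₂ t) _ = old-new x t
  edge-exists (inj₂ t) (inj₁ x) _ = let (b , e) = old-new x t in b , swap e
  edge-exists (inj₂ t) (inj₂ t′) t≢t′ with adjacent (t≢t′ ∘′ cong inj₂)
  ... | inj₁ refl = inj₂ (inj₂ t) , inj₁ (refl , 0F , refl)
  ... | inj₂ refl = inj₂ (inj₂ t′) , inj₂ (refl , 0F , refl)

  arc-unique′ : ∀ b b′ {u v} → Arc (claw′ b) u v → Arc (claw′ b′) u v → b ≡ b′
  arc-unique′ (inj₁ b) (inj₁ b′) (refl , i , refl) (p , i′ , q) =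
    cong inj₁ (arc-unique S (refl , i , refl) (inj₁-injective p , i′ , inj₁-injective q))
  arc-unique′ (inj₂ (inj₁ w)) (inj₂ (inj₁ w′)) (refl , _) (p , _) =
    cong (inj₂ ∘′ inj₁) (ψ-injective (inj₁-injective p))
  arc-unique′ (inj₂ (inj₂ t)) (inj₂ (inj₂ t′)) (refl , _) (p , _) =
    cong (inj₂ ∘′ inj₂) (inj₂-injective p)
  arc-unique′ (inj₁ b) (inj₂ (inj₁ w)) (refl , i , refl) (_ , _ , ())
  arc-unique′ (inj₁ b) (inj₂ (inj₂ t)) (refl , _) (() , _)
  arc-unique′ (inj₂ (inj₁ w)) (inj₁ b′) (refl , i , refl) (_ , _ , ())
  arc-unique′ (inj₂ (inj₁ w)) (inj₂ (inj₂ t)) (refl , _) (() , _)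
  arc-unique′ (inj₂ (inj₂ t)) (inj₁ b) (refl , _) (() , _)
  arc-unique′ (inj₂ (inj₂ t)) (inj₂ (inj₁ w)) (refl , _) (() , _)

  arc-asymmetric′ : ∀ b b′ {u v} → Arc (claw′ b) u v → ¬ Arc (claw′ b′) v u
  arc-asymmetric′ (inj₁ b) (inj₁ b′) (refl , i , refl) (p , i′ , q) =
    arc-asymmetric S (refl , i , refl) (inj₁-injective p , i′ , inj₁-injective q)
  arc-asymmetric′ (inj₂ (inj₁ w)) (inj₂ (inj₂ t)) (refl , i , refl) (refl , 1F , q) =
    ψ≢x₀ w (inj₁-injective q)
  arc-asymmetric′ (inj₂ (inj₁ w)) (inj₂ (inj₂ t)) (refl , i , refl) (refl , 2F , q) =
    ψ≢x₁ w (inj₁-injective q)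
  arc-asymmetric′ (inj₂ (inj₂ t)) (inj₂ (inj₁ w)) (refl , 1F , refl) (p , _) =
    ψ≢x₀ w (sym (inj₁-injective p))
  arc-asymmetric′ (inj₂ (inj₂ t)) (inj₂ (inj₁ w)) (refl , 2F , refl) (p , _) =
    ψ≢x₁ w (sym (inj₁-injective p))
  arc-asymmetric′ (inj₂ (inj₂ t)) (inj₂ (inj₂ _)) (refl , 0F , refl) (refl , 0F , q) =
    next²≢ t (sym (inj₂-injective q))
  arc-asymmetric′ (inj₂ (inj₂ t)) (inj₂ (inj₂ _)) (refl , 0F , refl) (refl , 1F , ())
  arc-asymmetric′ (inj₂ (inj₂ t)) (inj₂ (inj₂ _)) (refl , 0F , refl) (refl , 2F , ())
  arc-asymmetric′ (inj₂ (inj₂ t)) (inj₂ (inj₂ _)) (refl , 1F , refl) (() , _)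
  arc-asymmetric′ (inj₂ (inj₂ t)) (inj₂ (inj₂ _)) (refl , 2F , refl) (() , _)
  arc-asymmetric′ (inj₁ b) (inj₂ (inj₁ w)) (refl , i , refl) (_ , _ , ())
  arc-asymmetric′ (inj₁ b) (inj₂ (inj₂ t)) (refl , i , refl) (() , _)

  old-vertex : ∀ b {x} → VertexOf (claw′ (inj₁ b)) (inj₁ x) → VertexOf (claw S b) x
  old-vertex b = lift-vertex inj₁-injective (claw S b)

  spoke-vertex : ∀ {w x} → VertexOf (spoke w) (inj₁ x) → x ≡ ψ w
  spoke-vertex (inj₁ p) = inj₁-injective p

  old-spoke-disjoint : ∀ {b w} → colour S b ≡ φ w → Disjoint (claw′ (inj₁ b)) (spoke w)
  old-spoke-disjoint {b} c≡ (inj₁ x) (v , v′) with spoke-vertex v′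
  ... | refl = φ-free c≡ (old-vertex b v)
  old-spoke-disjoint c≡ (inj₂ t) (inj₁ () , _)
  old-spoke-disjoint c≡ (inj₂ t) (inj₂ (_ , ()) , _)

  monochromatic-disjoint′ : ∀ b b′ → b ≢ b′ → colour′ b ≡ colour′ b′ → Disjoint (claw′ b) (claw′ b′)
  monochromatic-disjoint′ (inj₁ b) (inj₁ b′) b≢b′ c≡ (inj₁ x) (v , v′) =
    monochromatic-disjoint S b b′ (b≢b′ ∘′ cong inj₁) (inj₁-injective c≡) x
      (old-vertex b v , old-vertex b′ v′)
  monochromatic-disjoint′ (inj₁ b) (inj₁ b′) _ _ (inj₂ t) (inj₁ () , _)
  monochromatic-disjoint′ (inj₁ b) (inj₁ b′) _ _ (inj₂ t) (inj₂ (_ , ()) , _)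
  monochromatic-disjoint′ (inj₁ b) (inj₂ (inj₁ w)) _ c≡ = old-spoke-disjoint (inj₁-injective c≡)
  monochromatic-disjoint′ (inj₂ (inj₁ w)) (inj₁ b) _ c≡ =
    disjoint-sym {s = claw′ (inj₁ b)} {spoke w} (old-spoke-disjoint (inj₁-injective (sym c≡)))
  monochromatic-disjoint′ (inj₂ (inj₁ w)) (inj₂ (inj₁ w′)) b≢b′ c≡ =
    ⊥-elim (b≢b′ (cong (inj₂ ∘′ inj₁) (φ-injective (inj₁-injective c≡))))
  monochromatic-disjoint′ (inj₂ (inj₂ t)) (inj₂ (inj₂ t′)) b≢b′ refl = ⊥-elim (b≢b′ refl)

  extended : ColouredClawSystem V′
  extended = record
    { Block = Block′
    ; claw = claw′
    ; edge-unique = λ u v u≢v →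
        edge-unique-from-arcs claw′ arc-unique′ arc-asymmetric′ (edge-exists u v u≢v)
    ; Colour = Colour S ⊎ Fin 3
    ; colour = colour′
    ; colour-surjective = colour-surjective′
    ; monochromatic-disjoint = monochromatic-disjoint′
    }
    where
    colour-surjective′ : ∀ c → ∃[ b ] colour′ b ≡ c
    colour-surjective′ (inj₁ c) = let (b , p) = colour-surjective S c in inj₁ b , cong inj₁ p
    colour-surjective′ (inj₂ t) = inj₂ (inj₂ t) , refl

-- Residues modulo q

module Residues (q : ℕ) .{{_ : NonZero q}} where

  [_] : ℕ → Fin q
  [ m ] = m mod q

  toℕ-[] : ∀ m → toℕ [ m ] ≡ m % q
  toℕ-[] m = toℕ-fromℕ< (m%n<n m q)

  []-cong% : ∀ {m n} → m % q ≡ n % q → [ m ] ≡ [ n ]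
  []-cong% {m} {n} e = fromℕ<-cong _ _ e (m%n<n m q) (m%n<n n q)

  []-toℕ : ∀ a → [ toℕ a ] ≡ a
  []-toℕ a = toℕ-injective (trans (toℕ-[] (toℕ a)) (m<n⇒m%n≡m (toℕ<n a)))

  toℕ-[]-< : ∀ {m} → m < q → toℕ [ m ] ≡ m
  toℕ-[]-< {m} m<q = trans (toℕ-[] m) (m<n⇒m%n≡m m<q)

  []-injective : ∀ {m n} → m < q → n < q → [ m ] ≡ [ n ] → m ≡ n
  []-injective m<q n<q e = trans (sym (toℕ-[]-< m<q)) (trans (cong toℕ e) (toℕ-[]-< n<q))

  infixl 6 _⊕_
  _⊕_ : Fin q → Fin q → Fin q
  a ⊕ b = [ toℕ a + toℕ b ]

  ⊖_ : Fin q → Fin q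
  ⊖ a = [ q ∸ toℕ a ]

  0# : Fin q
  0# = [ 0 ]

  ⊕-homo : ∀ m n → [ m ] ⊕ [ n ] ≡ [ m + n ]
  ⊕-homo m n = []-cong% (begin
    (toℕ [ m ] + toℕ [ n ]) % q ≡⟨ cong₂ (λ x y → (x + y) % q) (toℕ-[] m) (toℕ-[] n) ⟩
    (m % q + n % q) % q         ≡⟨ %-distribˡ-+ m n q ⟨
    (m + n) % q                 ∎)
    where open ≡-Reasoning

  ⊖-homo : ∀ {d} → d < q → ⊖ [ d ] ≡ [ q ∸ d ]
  ⊖-homo d<q = cong (λ x → [ q ∸ x ]) (toℕ-[]-< d<q)

  isAbelianGroup : IsAbelianGroup _≡_ _⊕_ 0# ⊖_
  isAbelianGroup = record
    { isGroup = record
      { isMonoid = record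
        { isSemigroup = record
          { isMagma = record { isEquivalence = isEquivalence ; ∙-cong = cong₂ _⊕_ }
          ; assoc = assoc
          }
        ; identity = identityˡ , identityʳ
        }
      ; inverse = inverseˡ , inverseʳ
      ; ⁻¹-cong = cong ⊖_
      }
    ; comm = comm
    }
    where
    open ≡-Reasoning
    comm : ∀ a b → a ⊕ b ≡ b ⊕ a
    comm a b = cong [_] (+-comm (toℕ a) (toℕ b))
    assoc : ∀ a b c → (a ⊕ b) ⊕ c ≡ a ⊕ (b ⊕ c)
    assoc a b c = begin
      (a ⊕ b) ⊕ c           ≡⟨ cong ((a ⊕ b) ⊕_) ([]-toℕ c) ⟨
      [ a′ + b′ ] ⊕ [ c′ ]  ≡⟨ ⊕-homo (a′ + b′) c′ ⟩
      [ a′ + b′ + c′ ]      ≡⟨ cong [_] (+-assoc a′ b′ c′) ⟩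
      [ a′ + (b′ + c′) ]    ≡⟨ ⊕-homo a′ (b′ + c′) ⟨
      [ a′ ] ⊕ (b ⊕ c)      ≡⟨ cong (_⊕ (b ⊕ c)) ([]-toℕ a) ⟩
      a ⊕ (b ⊕ c)           ∎
      where a′ = toℕ a ; b′ = toℕ b ; c′ = toℕ c
    identityʳ : ∀ a → a ⊕ 0# ≡ a
    identityʳ a = begin
      a ⊕ 0#             ≡⟨ cong (_⊕ 0#) ([]-toℕ a) ⟨
      [ toℕ a ] ⊕ [ 0 ]  ≡⟨ ⊕-homo (toℕ a) 0 ⟩
      [ toℕ a + 0 ]      ≡⟨ cong [_] (+-identityʳ (toℕ a)) ⟩
      [ toℕ a ]          ≡⟨ []-toℕ a ⟩
      a                  ∎
    identityˡ : ∀ a → 0# ⊕ a ≡ a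
    identityˡ a = trans (comm 0# a) (identityʳ a)
    inverseʳ : ∀ a → a ⊕ ⊖ a ≡ 0#
    inverseʳ a = begin
      a ⊕ ⊖ a                    ≡⟨ cong (_⊕ ⊖ a) ([]-toℕ a) ⟨
      [ toℕ a ] ⊕ [ q ∸ toℕ a ]  ≡⟨ ⊕-homo (toℕ a) (q ∸ toℕ a) ⟩
      [ toℕ a + (q ∸ toℕ a) ]    ≡⟨ cong [_] (m+[n∸m]≡n (<⇒≤ (toℕ<n a))) ⟩
      [ q ]                      ≡⟨ []-cong% (trans (n%n≡0 q) (sym (m<n⇒m%n≡m (>-nonZero⁻¹ q)))) ⟩
      0#                         ∎
    inverseˡ : ∀ a → ⊖ a ⊕ a ≡ 0#
    inverseˡ a = trans (comm (⊖ a) a) (inverseʳ a)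

  abelianGroup : AbelianGroup _ _
  abelianGroup = record { isAbelianGroup = isAbelianGroup }

module SignedResidues (h : ℕ) where

  q : ℕ
  q = suc (h + h)

  open Residues q public
  open AbelianGroupProperties abelianGroup
    using (⁻¹-involutive; ⁻¹-injective)

  signed : Sign → ℕ → Fin q
  signed Sign.+ d = [ d ]
  signed Sign.- d = ⊖ [ d ]

  signed-opposite : ∀ σ d → signed (opposite σ) d ≡ ⊖ signed σ d
  signed-opposite Sign.+ d = refl
  signed-opposite Sign.- d = sym (⁻¹-involutive [ d ])

  ≤h⇒<q : ∀ {d} → d ≤ h → d < q
  ≤h⇒<q d≤h = s≤s (≤-trans d≤h (m≤m+n h h))

  plus≢minus : ∀ {d d′} → d ≤ h → 0 < d′ → d′ ≤ h → [ d ] ≢ ⊖ [ d′ ]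
  plus≢minus {d} {d′} d≤h 0<d′ d′≤h e = <⇒≢ (s≤s (+-mono-≤ d≤h d′≤h)) d+d′≡q
    where
    q∸d′<q : q ∸ d′ < q
    q∸d′<q = ∸-monoʳ-< 0<d′ (<⇒≤ (≤h⇒<q d′≤h))
    d+d′≡q : d + d′ ≡ q
    d+d′≡q = trans (cong (_+ d′) ([]-injective (≤h⇒<q d≤h) q∸d′<q (trans e (⊖-homo (≤h⇒<q d′≤h)))))
                   (m∸n+n≡m (<⇒≤ (≤h⇒<q d′≤h)))

  signed-injective : ∀ σ σ′ {d d′} → 0 < d → d ≤ h → 0 < d′ → d′ ≤ h →
                     signed σ d ≡ signed σ′ d′ → σ ≡ σ′ × d ≡ d′
  signed-injective Sign.+ Sign.+ _ d≤h _ d′≤h e = refl , []-injective (≤h⇒<q d≤h) (≤h⇒<q d′≤h) e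
  signed-injective Sign.- Sign.- _ d≤h _ d′≤h e =
    refl , []-injective (≤h⇒<q d≤h) (≤h⇒<q d′≤h) (⁻¹-injective e)
  signed-injective Sign.+ Sign.- _ d≤h 0<d′ d′≤h e = ⊥-elim (plus≢minus d≤h 0<d′ d′≤h e)
  signed-injective Sign.- Sign.+ 0<d d≤h _ d′≤h e = ⊥-elim (plus≢minus d′≤h 0<d d≤h (sym e))

  signed-surjective : ∀ e → e ≢ 0# → ∃[ σ ] ∃[ d ] 0 < d × d ≤ h × e ≡ signed σ d
  signed-surjective e e≢0 with toℕ e ≤? h
  ... | yes e≤h = Sign.+ , toℕ e , 0<e , e≤h , sym ([]-toℕ e)
    where
    0<e : 0 < toℕ e
    0<e = n≢0⇒n>0 (e≢0 ∘′ λ p → trans (sym ([]-toℕ e)) (cong [_] p))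
  ... | no e≰h = Sign.- , q ∸ toℕ e , m<n⇒0<n∸m (toℕ<n e) , q∸e≤h , sym (begin
      ⊖ [ q ∸ toℕ e ]      ≡⟨ ⊖-homo (∸-monoʳ-< (≤-<-trans z≤n (≰⇒> e≰h)) (<⇒≤ (toℕ<n e))) ⟩
      [ q ∸ (q ∸ toℕ e) ]  ≡⟨ cong [_] (m∸[m∸n]≡n (<⇒≤ (toℕ<n e))) ⟩
      [ toℕ e ]            ≡⟨ []-toℕ e ⟩
      e                    ∎)
    where
    open ≡-Reasoning
    q∸e≤h : q ∸ toℕ e ≤ h
    q∸e≤h = ≤-trans (∸-monoʳ-≤ q (≰⇒> e≰h)) (≤-reflexive (m+n∸m≡n h h))

-- The base stars

digits-unique : ∀ {n a b x y} .{{_ : NonZero n}} → x < n → y < n →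
                x + a * n ≡ y + b * n → x ≡ y × a ≡ b
digits-unique {n} {a} {b} {x} {y} x<n y<n e =
  x≡y , *-cancelʳ-≡ a b n (+-cancelˡ-≡ x _ _ (trans e (cong (_+ b * n) (sym x≡y))))
  where
  open ≡-Reasoning
  x≡y : x ≡ y
  x≡y = begin
    x                ≡⟨ m<n⇒m%n≡m x<n ⟨
    x % n            ≡⟨ [m+kn]%n≡m%n x a n ⟨
    (x + a * n) % n  ≡⟨ cong (_% n) e ⟩
    (y + b * n) % n  ≡⟨ [m+kn]%n≡m%n y b n ⟩
    y % n            ≡⟨ m<n⇒m%n≡m y<n ⟩
    y                ∎

-- With k = r − j, base star j is centred at 2r + 3 + j with offsets +(3k + 1), −(3j + 3) and
-- −(3j + 2), so its leaves sit at 3r + 4 + 2k, 2k and 2k + 1.  Hence the differences 1, …, 3r + 3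
-- occur once each, distinct base stars occupy distinct positions, and position 2r + 2 is free.
module CyclicStarter (r h : ℕ) (2+3r≤h : 2 + r * 3 ≤ h) (h≤3+3r : h ≤ 3 + r * 3) where

  open SignedResidues h
  open IsAbelianGroup isAbelianGroup using (comm; identityˡ)
  open AbelianGroupProperties abelianGroup
    using (//-rightDividesʳ; ⁻¹-involutive)
  open Development isAbelianGroup

  J : Set
  J = Fin (suc r)

  -- a single fixed point ∞ when h = 3r + 2, none when h = 3r + 3
  Fixed : Set
  Fixed = h < 3 + r * 3

  mirror : J → ℕ
  mirror j = r ∸ toℕ j

  j+mirror≡r : ∀ j → toℕ j + mirror j ≡ r
  j+mirror≡r j = m+[n∸m]≡n (s≤s⁻¹ (toℕ<n j))

  mirror≤r : ∀ j → mirror j ≤ r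
  mirror≤r j = m∸n≤m r (toℕ j)

  mirror-injective : ∀ {j j′} → mirror j ≡ mirror j′ → j ≡ j′
  mirror-injective {j} {j′} e =
    toℕ-injective (∸-cancelˡ-≡ (s≤s⁻¹ (toℕ<n j)) (s≤s⁻¹ (toℕ<n j′)) e)

  remainder : Fin 3 → ℕ
  remainder 0F = 1
  remainder 1F = 0
  remainder 2F = 2

  quotient : J → Fin 3 → ℕ
  quotient j 0F = mirror j
  quotient j 1F = suc (toℕ j)
  quotient j 2F = toℕ j

  difference : J → Fin 3 → ℕ
  difference j i = remainder i + quotient j i * 3

  remainder<3 : ∀ i → remainder i < 3
  remainder<3 0F = s≤s (s≤s z≤n)
  remainder<3 1F = s≤s z≤n
  remainder<3 2F = s≤s (s≤s (s≤s z≤n))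

  difference-positive : ∀ j i → 0 < difference j i
  difference-positive j 0F = s≤s z≤n
  difference-positive j 1F = s≤s z≤n
  difference-positive j 2F = s≤s z≤n

  difference≤3+3r : ∀ j i → difference j i ≤ 3 + r * 3
  difference≤3+3r j 0F = +-mono-≤ (s≤s z≤n) (*-monoˡ-≤ 3 (mirror≤r j))
  difference≤3+3r j 1F = *-monoˡ-≤ 3 (toℕ<n j)
  difference≤3+3r j 2F = +-mono-≤ (s≤s (s≤s z≤n)) (*-monoˡ-≤ 3 (s≤s⁻¹ (toℕ<n j)))

  remainder-injective : ∀ {i i′} → remainder i ≡ remainder i′ → i ≡ i′
  remainder-injective {0F} {0F} _ = refl
  remainder-injective {1F} {1F} _ = refl
  remainder-injective {2F} {2F} _ = refl
  remainder-injective {0F} {1F} ()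
  remainder-injective {0F} {2F} ()
  remainder-injective {1F} {2F} ()

  quotient-injective : ∀ {j j′} i → quotient j i ≡ quotient j′ i → j ≡ j′
  quotient-injective 0F = mirror-injective
  quotient-injective 1F = toℕ-injective ∘′ suc-injective
  quotient-injective 2F = toℕ-injective

  difference-injective : ∀ {j j′ i i′} → difference j i ≡ difference j′ i′ → j ≡ j′ × i ≡ i′
  difference-injective {j} {j′} {i} {i′} e
    with digits-unique {a = quotient j i} {b = quotient j′ i′} (remainder<3 i) (remainder<3 i′) e
  ... | r≡r′ , q≡q′ with remainder-injective r≡r′
  ... | refl = quotient-injective i q≡q′ , refl

  digits-surjective : ∀ x a → x < 3 → 0 < x + a * 3 → x + a * 3 ≤ 3 + r * 3 →
                      ∃[ j ] ∃[ i ] difference j i ≡ x + a * 3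
  digits-surjective 0 (suc a) _ _ le =
    fromℕ< a<1+r , 1F , cong (λ b → suc b * 3) (toℕ-fromℕ< a<1+r)
    where
    a<1+r : a < suc r
    a<1+r = *-cancelʳ-≤ (suc a) (suc r) 3 le
  digits-surjective 1 a _ _ le =
    fromℕ< r∸a<1+r , 0F , cong (λ b → 1 + b * 3) mirror≡a
    where
    a≤r : a ≤ r
    a≤r = s≤s⁻¹ (*-cancelʳ-< 3 a (suc r) le)
    r∸a<1+r : r ∸ a < suc r
    r∸a<1+r = s≤s (m∸n≤m r a)
    mirror≡a : r ∸ toℕ (fromℕ< r∸a<1+r) ≡ a
    mirror≡a = trans (cong (r ∸_) (toℕ-fromℕ< r∸a<1+r)) (m∸[m∸n]≡n a≤r)
  digits-surjective 2 a _ _ le =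
    fromℕ< a<1+r , 2F , cong (λ b → 2 + b * 3) (toℕ-fromℕ< a<1+r)
    where
    a<1+r : a < suc r
    a<1+r = *-cancelʳ-< 3 a (suc r) (≤-trans (n≤1+n _) le)
  digits-surjective (suc (suc (suc _))) _ (s≤s (s≤s (s≤s ()))) _ _

  difference-surjective : ∀ {d} → 0 < d → d ≤ 3 + r * 3 → ∃[ j ] ∃[ i ] difference j i ≡ d
  difference-surjective {d} 0<d d≤ with digits-surjective (d % 3) (d / 3) (m%n<n d 3)
    (subst (0 <_) (m≡m%n+[m/n]*n d 3) 0<d) (subst (_≤ 3 + r * 3) (m≡m%n+[m/n]*n d 3) d≤)
  ... | j , i , e = j , i , trans e (sym (m≡m%n+[m/n]*n d 3))

  sign : Fin 3 → Sign
  sign 0F      = Sign.+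
  sign (Fin.suc _) = Sign.-

  sign-or-opposite : ∀ σ τ → σ ≡ τ ⊎ σ ≡ opposite τ
  sign-or-opposite Sign.+ Sign.+ = inj₁ refl
  sign-or-opposite Sign.+ Sign.- = inj₂ refl
  sign-or-opposite Sign.- Sign.+ = inj₂ refl
  sign-or-opposite Sign.- Sign.- = inj₁ refl

  offset : J → Fin 3 → Fin q ⊎ Fixed
  offset j i with difference j i ≤? h
  ... | yes _   = inj₁ (signed (sign i) (difference j i))
  ... | no d≰h = inj₂ (<-≤-trans (≰⇒> d≰h) (difference≤3+3r j i))

  offset-in-range : ∀ j i → difference j i ≤ h →
                    offset j i ≡ inj₁ (signed (sign i) (difference j i))
  offset-in-range j i d≤h with difference j i ≤? h
  ... | yes _   = refl
  ... | no d≰h = ⊥-elim (d≰h d≤h)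

  offset-out-of-range : ∀ j i → h < difference j i → ∀ f → offset j i ≡ inj₂ f
  offset-out-of-range j i h<d f with difference j i ≤? h
  ... | yes d≤h = ⊥-elim (<⇒≱ h<d d≤h)
  ... | no _    = cong inj₂ (<-irrelevant _ f)

  group-offset : ∀ {j i d} → offset j i ≡ inj₁ d →
                 difference j i ≤ h × d ≡ signed (sign i) (difference j i)
  group-offset {j} {i} eq with difference j i ≤? h | eq
  ... | yes d≤h | refl = d≤h , refl

  fixed-offset : ∀ {j i f} → offset j i ≡ inj₂ f → difference j i ≡ 3 + r * 3
  fixed-offset {j} {i} eq with difference j i ≤? h | eq
  ... | no d≰h | _ = ≤-antisym (difference≤3+3r j i) (≤-trans (s≤s 2+3r≤h) (≰⇒> d≰h))

  position : J → Maybe (Fin 3) → ℕ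
  position j nothing             = 3 + r * 2 + toℕ j
  position j (just 0F)           = 4 + r * 3 + mirror j * 2
  position j (just (Fin.suc i)) = toℕ i + mirror j * 2

  base : J → Fin q
  base j = [ position j nothing ]

  by-mirror : (P : ℕ → ℕ → ℕ → Set) → (∀ a k → P a k (a + k)) → ∀ j → P (toℕ j) (mirror j) r
  by-mirror P p j = subst (P (toℕ j) (mirror j)) (j+mirror≡r j) (p (toℕ j) (mirror j))

  near-arithmetic : ∀ j i →
    position j (just (Fin.suc i)) + difference j (Fin.suc i) ≡ position j nothing
  near-arithmetic j 0F = by-mirror (λ a k r → k * 2 + suc a * 3 ≡ 3 + r * 2 + a) solve-∀ j
  near-arithmetic j 1F = by-mirror (λ a k r → 1 + k * 2 + (2 + a * 3) ≡ 3 + r * 2 + a) solve-∀ j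

  far-arithmetic : ∀ j → difference j 0F + position j nothing ≡ position j (just 0F)
  far-arithmetic = by-mirror (λ a k r → 1 + k * 3 + (3 + r * 2 + a) ≡ 4 + r * 3 + k * 2) solve-∀

  leaf-position : ∀ j i → signed (sign i) (difference j i) ⊕ base j ≡ [ position j (just i) ]
  leaf-position j 0F =
    trans (⊕-homo (difference j 0F) (position j nothing)) (cong [_] (far-arithmetic j))
  leaf-position j (Fin.suc i) = begin
    ⊖ [ d ] ⊕ [ position j nothing ]  ≡⟨ comm (⊖ [ d ]) _ ⟩
    [ position j nothing ] ⊕ ⊖ [ d ]  ≡⟨ cong (_⊕ ⊖ [ d ]) p⊕d≡hub ⟨
    [ p ] ⊕ [ d ] ⊕ ⊖ [ d ]           ≡⟨ //-rightDividesʳ [ d ] [ p ] ⟩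
    [ p ]                             ∎
    where
    open ≡-Reasoning
    d = difference j (Fin.suc i)
    p = position j (just (Fin.suc i))
    p⊕d≡hub : [ p ] ⊕ [ d ] ≡ [ position j nothing ]
    p⊕d≡hub = trans (⊕-homo p d) (cong [_] (near-arithmetic j i))

  near≤ : ∀ j i → position j (just (Fin.suc i)) ≤ 1 + r * 2
  near≤ j i = +-mono-≤ (s≤s⁻¹ (toℕ<n i)) (*-monoˡ-≤ 2 (mirror≤r j))

  hub≤ : ∀ j → position j nothing ≤ 3 + r * 2 + r
  hub≤ j = +-monoʳ-≤ (3 + r * 2) (s≤s⁻¹ (toℕ<n j))

  far≤ : ∀ j → position j (just 0F) ≤ 4 + r * 3 + r * 2
  far≤ j = +-monoʳ-≤ (4 + r * 3) (*-monoˡ-≤ 2 (mirror≤r j))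

  near<hub : ∀ j i j′ → position j (just (Fin.suc i)) < position j′ nothing
  near<hub j i j′ = ≤-trans (s≤s (near≤ j i)) (≤-trans (n≤1+n _) (m≤m+n (3 + r * 2) (toℕ j′)))

  hub<far : ∀ j j′ → position j nothing < position j′ (just 0F)
  hub<far j j′ = begin-strict
    position j nothing      ≤⟨ hub≤ j ⟩
    3 + r * 2 + r           <⟨ n<1+n _ ⟩
    suc (3 + r * 2 + r)     ≡⟨ arithmetic r ⟩
    4 + r * 3               ≤⟨ m≤m+n (4 + r * 3) (mirror j′ * 2) ⟩
    position j′ (just 0F)   ∎
    where
    open ≤-Reasoning
    arithmetic : ∀ r → suc (3 + r * 2 + r) ≡ 4 + r * 3
    arithmetic = solve-∀

  near<far : ∀ j i j′ → position j (just (Fin.suc i)) < position j′ (just 0F)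
  near<far j i j′ = <-trans (near<hub j i j′) (hub<far j′ j′)

  position-owner : ∀ j j′ p p′ → position j p ≡ position j′ p′ → j ≡ j′
  position-owner j j′ nothing nothing e = toℕ-injective (+-cancelˡ-≡ (3 + r * 2) _ _ e)
  position-owner j j′ (just 0F) (just 0F) e =
    mirror-injective (*-cancelʳ-≡ _ _ 2 (+-cancelˡ-≡ (4 + r * 3) _ _ e))
  position-owner j j′ (just (Fin.suc i)) (just (Fin.suc i′)) e =
    mirror-injective (proj₂ (digits-unique (toℕ<n i) (toℕ<n i′) e))
  position-owner j j′ nothing (just 0F) e = ⊥-elim (<⇒≢ (hub<far j j′) e)
  position-owner j j′ nothing (just (Fin.suc i′)) e = ⊥-elim (<⇒≢ (near<hub j′ i′ j) (sym e))
  position-owner j j′ (just 0F) nothing e = ⊥-elim (<⇒≢ (hub<far j′ j) (sym e))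
  position-owner j j′ (just 0F) (just (Fin.suc i′)) e = ⊥-elim (<⇒≢ (near<far j′ i′ j) (sym e))
  position-owner j j′ (just (Fin.suc i)) nothing e = ⊥-elim (<⇒≢ (near<hub j i j′) e)
  position-owner j j′ (just (Fin.suc i)) (just 0F) e = ⊥-elim (<⇒≢ (near<far j i j′) e)

  gap : ℕ
  gap = 2 + r * 2

  gap<hub : ∀ j → gap < position j nothing
  gap<hub j = m≤m+n (3 + r * 2) (toℕ j)

  position≢gap : ∀ j p → position j p ≢ gap
  position≢gap j nothing             = ≢-sym (<⇒≢ (gap<hub j))
  position≢gap j (just 0F)           = ≢-sym (<⇒≢ (<-trans (gap<hub j) (hub<far j j)))
  position≢gap j (just (Fin.suc i)) = <⇒≢ (s≤s (near≤ j i))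

  position≤far : ∀ j p → position j p ≤ 4 + r * 3 + r * 2
  position≤far j nothing            = <⇒≤ (<-≤-trans (hub<far j j) (far≤ j))
  position≤far j (just 0F)          = far≤ j
  position≤far j (just (Fin.suc i)) = <⇒≤ (<-≤-trans (near<far j i j) (far≤ j))

  position<q : ∀ j p → position j p < q
  position<q j p = s≤s (begin
    position j p                  ≤⟨ position≤far j p ⟩
    4 + r * 3 + r * 2             ≤⟨ m≤m+n _ r ⟩
    4 + r * 3 + r * 2 + r         ≡⟨ arithmetic r ⟩
    (2 + r * 3) + (2 + r * 3)     ≤⟨ +-mono-≤ 2+3r≤h 2+3r≤h ⟩
    h + h                         ∎)
    where
    open ≤-Reasoning
    arithmetic : ∀ r → 4 + r * 3 + r * 2 + r ≡ (2 + r * 3) + (2 + r * 3)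
    arithmetic = solve-∀

  reach-position : ∀ {j d} → Reaches offset j d → ∃[ p ] d ⊕ base j ≡ [ position j p ]
  reach-position {j} (inj₁ refl) = nothing , identityˡ (base j)
  reach-position {j} (inj₂ (i , eq)) with group-offset eq
  ... | _ , refl = just i , leaf-position j i

  last : J
  last = fromℕ r

  last-difference : 3 + r * 3 ≡ difference last 1F
  last-difference = cong (λ a → suc a * 3) (sym (toℕ-fromℕ r))

  offsets-cover : ∀ d → d ≢ 0# → ∃[ j ] ∃[ i ] (offset j i ≡ inj₁ d ⊎ offset j i ≡ inj₁ (⊖ d))
  offsets-cover d d≢0 with signed-surjective d d≢0
  ... | σ , δ , 0<δ , δ≤h , refl with difference-surjective 0<δ (≤-trans δ≤h h≤3+3r)
  ... | j , i , refl with sign-or-opposite σ (sign i)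
  ... | inj₁ refl = j , i , inj₁ (offset-in-range j i δ≤h)
  ... | inj₂ refl = j , i , inj₂ (trans (offset-in-range j i δ≤h) (cong inj₁ (begin
    signed (sign i) δ               ≡⟨ ⁻¹-involutive _ ⟨
    ⊖ ⊖ signed (sign i) δ           ≡⟨ cong ⊖_ (signed-opposite (sign i) δ) ⟨
    ⊖ signed (opposite (sign i)) δ  ∎)))
    where open ≡-Reasoning

  signed-difference-injective : ∀ {j j′ i i′} σ σ′ → difference j i ≤ h → difference j′ i′ ≤ h →
    signed σ (difference j i) ≡ signed σ′ (difference j′ i′) → σ ≡ σ′ × j ≡ j′ × i ≡ i′
  signed-difference-injective {j} {j′} {i} {i′} σ σ′ d≤h d′≤h e
    with signed-injective σ σ′ (difference-positive j i) d≤h (difference-positive j′ i′) d′≤h e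
  ... | σ≡σ′ , d≡d′ = σ≡σ′ , difference-injective d≡d′

  offsets-unique : ∀ {j j′ i i′ d} → offset j i ≡ inj₁ d → offset j′ i′ ≡ inj₁ d → j ≡ j′ × i ≡ i′
  offsets-unique {i = i} {i′} eq eq′ with group-offset eq | group-offset eq′
  ... | d≤h , refl | d′≤h , e =
    proj₂ (signed-difference-injective (sign i) (sign i′) d≤h d′≤h e)

  offsets-not-opposite : ∀ {j j′ i i′ d} → offset j i ≡ inj₁ d → offset j′ i′ ≢ inj₁ (⊖ d)
  offsets-not-opposite {j} {j′} {i} {i′} eq eq′ with group-offset eq | group-offset eq′
  ... | d≤h , refl | d′≤h , e
    with signed-difference-injective {j} {j′} {i} {i′} (opposite (sign i)) (sign i′) d≤h d′≤h
           (trans (signed-opposite (sign i) (difference j i)) e)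
  ... | opposite≡ , refl , refl = s≢opposite[s] (sign i) (sym opposite≡)

  base-stars-disjoint : ∀ {j j′ d d′} → Reaches offset j d → Reaches offset j′ d′ →
                        d ⊕ base j ≡ d′ ⊕ base j′ → j ≡ j′
  base-stars-disjoint {j} {j′} reach reach′ e with reach-position reach | reach-position reach′
  ... | p , e₁ | p′ , e₂ = position-owner j j′ p p′
    ([]-injective (position<q j p) (position<q j′ p′) (trans (sym e₁) (trans e e₂)))

  starter : Starter J Fixed
  starter = record
    { base = base
    ; offset = offset
    ; offset-covers = offsets-cover
    ; offset-unique = offsets-unique
    ; offset-not-opposite = offsets-not-opposite
    ; fixed-covered = λ f → last , 1F , offset-out-of-range last 1F (subst (h <_) last-difference f) f
    ; fixed-unique = λ eq eq′ →
        difference-injective (trans (fixed-offset eq) (sym (fixed-offset eq′)))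
    ; fixed-irrelevant = <-irrelevant
    ; base-disjoint = base-stars-disjoint
    }

  gap-unreached : ∀ {j d} → Reaches offset j d → d ⊕ base j ≢ [ gap ]
  gap-unreached {j} reach e with reach-position reach
  ... | p , e′ = position≢gap j p
    ([]-injective (position<q j p) (<-trans (gap<hub j) (position<q j nothing)) (trans (sym e′) e))

-- The four families of orders

finite-sum : ∀ {A B : Set} {a b} → A ↔ Fin a → B ↔ Fin b → (A ⊎ B) ↔ Fin (a + b)
finite-sum e f = ↔-trans (e ⊎-↔ f) (↔-sym +↔⊎)

finite-product : ∀ {A B : Set} {a b} → A ↔ Fin a → B ↔ Fin b → (A × B) ↔ Fin (a * b)
finite-product e f = ↔-trans (e ×-↔ f) (↔-sym *↔×)

recount : ∀ {A : Set} {a b} → A ↔ Fin a → a ≡ b → A ↔ Fin b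
recount e refl = e

empty↔ : ∀ {A : Set} → ¬ A → A ↔ Fin 0
empty↔ ¬a = mk↔ₛ′ (⊥-elim ∘′ ¬a) (λ ()) (λ ()) (λ a → ⊥-elim (¬a a))

singleton↔ : ∀ {A : Set} → A → (∀ (a a′ : A) → a ≡ a′) → A ↔ Fin 1
singleton↔ a irrelevant =
  mk↔ₛ′ (λ _ → Fin.zero) (λ _ → a) (λ { Fin.zero → refl ; (Fin.suc ()) }) (irrelevant a)

module CyclicFamily (r h : ℕ) (2+3r≤h : 2 + r * 3 ≤ h) (h≤3+3r : h ≤ 3 + r * 3) where
  open SignedResidues h public
  open Development isAbelianGroup
  open CyclicStarter r h 2+3r≤h h≤3+3r public
  open Developed starter

  cyclic : ColouredClawSystem (Fin q ⊎ Fixed)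
  cyclic = system Fin.zero

  blocks↔ : Block cyclic ↔ Fin (suc r * q)
  blocks↔ = finite-product ↔-refl ↔-refl

  module WithThreePoints (x₀ x₁ : Fin q ⊎ Fixed) (x₀≢x₁ : x₀ ≢ x₁)
    {W : Set} (g : W → Fin q) (g-injective : ∀ {w w′} → g w ≡ g w′ → w ≡ w′)
    (g≢x₀ : ∀ w → inj₁ (g w) ≢ x₀) (g≢x₁ : ∀ w → inj₁ (g w) ≢ x₁)
    (covers : ∀ x → x ≡ x₀ ⊎ x ≡ x₁ ⊎ ∃[ w ] x ≡ inj₁ (g w)) where

    open AbelianGroupProperties abelianGroup using (∙-cancelʳ)

    extended : ColouredClawSystem ((Fin q ⊎ Fixed) ⊎ Fin 3)
    extended = AddThreePoints.extended cyclic x₀ x₁ x₀≢x₁ (inj₁ ∘′ g) (g-injective ∘′ inj₁-injective)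
      g≢x₀ g≢x₁ covers (λ w → g w ⊕ ⊖ [ gap ]) (g-injective ∘′ ∙-cancelʳ _ _ _)
      (free-in-class [ gap ] gap-unreached)

order-7+6r : ∀ r → ∃[ S ] BlockColourable {7 + r * 6} S (7 + r * 6)
order-7+6r r = realise cyclic vertices↔ blocks↔ (recount ↔-refl (q≡ r))
  where
  open CyclicFamily r (3 + r * 3) (n≤1+n _) ≤-refl
  q≡ : ∀ r → suc ((3 + r * 3) + (3 + r * 3)) ≡ 7 + r * 6
  q≡ = solve-∀
  vertices↔ : (Fin q ⊎ Fixed) ↔ Fin (7 + r * 6)
  vertices↔ = recount (finite-sum ↔-refl (empty↔ (<-irrefl refl))) (trans (+-identityʳ q) (q≡ r))

order-6+6r : ∀ r → ∃[ S ] BlockColourable {6 + r * 6} S (5 + r * 6)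
order-6+6r r = realise cyclic vertices↔ blocks↔ (recount ↔-refl (q≡ r))
  where
  open CyclicFamily r (2 + r * 3) ≤-refl (n≤1+n _)
  q≡ : ∀ r → suc ((2 + r * 3) + (2 + r * 3)) ≡ 5 + r * 6
  q≡ = solve-∀
  vertices↔ : (Fin q ⊎ Fixed) ↔ Fin (6 + r * 6)
  vertices↔ = recount (finite-sum ↔-refl (singleton↔ ≤-refl <-irrelevant))
                      (trans (+-comm q 1) (cong suc (q≡ r)))

order-10+6r : ∀ r → ∃[ S ] BlockColourable {10 + r * 6} S (10 + r * 6)
order-10+6r r = realise extended vertices↔ (finite-sum blocks↔ (finite-sum ↔-refl ↔-refl)) colours↔
  where
  open CyclicFamily r (3 + r * 3) (n≤1+n _) ≤-refl
  q+3≡ : ∀ r → suc ((3 + r * 3) + (3 + r * 3)) + 3 ≡ 10 + r * 6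
  q+3≡ = solve-∀
  covers : ∀ x → x ≡ inj₁ Fin.zero ⊎ x ≡ inj₁ (Fin.suc Fin.zero) ⊎
                 ∃[ w ] x ≡ inj₁ (Fin.suc (Fin.suc w))
  covers (inj₁ Fin.zero)                = inj₁ refl
  covers (inj₁ (Fin.suc Fin.zero))      = inj₂ (inj₁ refl)
  covers (inj₁ (Fin.suc (Fin.suc w)))   = inj₂ (inj₂ (w , refl))
  covers (inj₂ f)                       = ⊥-elim (<-irrefl refl f)
  open WithThreePoints (inj₁ Fin.zero) (inj₁ (Fin.suc Fin.zero)) (λ ()) (Fin.suc ∘′ Fin.suc)
    (Finₚ.suc-injective ∘′ Finₚ.suc-injective) (λ _ ()) (λ _ ()) covers
  vertices↔ : ((Fin q ⊎ Fixed) ⊎ Fin 3) ↔ Fin (10 + r * 6)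
  vertices↔ = recount (finite-sum (finite-sum ↔-refl (empty↔ (<-irrefl refl))) ↔-refl)
                      (trans (cong (_+ 3) (+-identityʳ q)) (q+3≡ r))
  colours↔ : (Fin q ⊎ Fin 3) ↔ Fin (10 + r * 6)
  colours↔ = recount (finite-sum ↔-refl ↔-refl) (q+3≡ r)

order-9+6r : ∀ r → ∃[ S ] BlockColourable {9 + r * 6} S (8 + r * 6)
order-9+6r r = realise extended vertices↔ (finite-sum blocks↔ (finite-sum ↔-refl ↔-refl)) colours↔
  where
  open CyclicFamily r (2 + r * 3) ≤-refl (n≤1+n _)
  q+3≡ : ∀ r → suc ((2 + r * 3) + (2 + r * 3)) + 3 ≡ 8 + r * 6
  q+3≡ = solve-∀
  ∞ : Fixed
  ∞ = ≤-refl
  covers : ∀ x → x ≡ inj₂ ∞ ⊎ x ≡ inj₁ Fin.zero ⊎ ∃[ w ] x ≡ inj₁ (Fin.suc w)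
  covers (inj₂ f)             = inj₁ (cong inj₂ (<-irrelevant f ∞))
  covers (inj₁ Fin.zero)      = inj₂ (inj₁ refl)
  covers (inj₁ (Fin.suc w))   = inj₂ (inj₂ (w , refl))
  open WithThreePoints (inj₂ ∞) (inj₁ Fin.zero) (λ ()) Fin.suc Finₚ.suc-injective
    (λ _ ()) (λ _ ()) covers
  vertices↔ : ((Fin q ⊎ Fixed) ⊎ Fin 3) ↔ Fin (9 + r * 6)
  vertices↔ = recount (finite-sum (finite-sum ↔-refl (singleton↔ ∞ <-irrelevant)) ↔-refl)
                      (trans (cong (_+ 3) (+-comm q 1)) (cong suc (q+3≡ r)))
  colours↔ : (Fin q ⊎ Fin 3) ↔ Fin (8 + r * 6)
  colours↔ = recount (finite-sum ↔-refl ↔-refl) (q+3≡ r)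

-- Admissible orders

double-choose-2 : ∀ n → 2 * (suc n C 2) ≡ suc n * n
double-choose-2 zero    = refl
double-choose-2 (suc n) = begin
  2 * (suc (suc n) C 2)           ≡⟨ cong (2 *_) (nCk+nC[k+1]≡[n+1]C[k+1] (suc n) 1) ⟨
  2 * (suc n C 1 + suc n C 2)     ≡⟨ cong (λ c → 2 * (c + suc n C 2)) (nC1≡n (suc n)) ⟩
  2 * (suc n + suc n C 2)         ≡⟨ *-distribˡ-+ 2 (suc n) (suc n C 2) ⟩
  2 * suc n + 2 * (suc n C 2)     ≡⟨ cong (2 * suc n +_) (double-choose-2 n) ⟩
  2 * suc n + suc n * n           ≡⟨ arithmetic n ⟩
  suc (suc n) * suc n             ∎
  where
  open ≡-Reasoning
  arithmetic : ∀ n → 2 * suc n + suc n * n ≡ suc (suc n) * suc n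
  arithmetic = solve-∀

3∤choose-2 : ∀ a → ¬ 3 ∣ (2 + a * 3) C 2
3∤choose-2 a 3∣C = ≤⇒≯ (∣⇒≤ 3∣2) (s≤s (s≤s (s≤s z≤n)))
  where
  expand : ∀ a → (2 + a * 3) * (1 + a * 3) ≡ (a * 3 + a * a * 3) * 3 + 2
  expand = solve-∀
  3∣2 : 3 ∣ 2
  3∣2 = ∣m+n∣m⇒∣n
    (subst (3 ∣_) (trans (double-choose-2 (1 + a * 3)) (expand a)) (∣-trans 3∣C (n∣m*n 2)))
    (n∣m*n (a * 3 + a * a * 3))

data AdmissibleOrder : ℕ → Set where
  6+6r  : ∀ r → AdmissibleOrder (6 + r * 6)
  7+6r  : ∀ r → AdmissibleOrder (7 + r * 6)
  9+6r  : ∀ r → AdmissibleOrder (9 + r * 6)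
  10+6r : ∀ r → AdmissibleOrder (10 + r * 6)

classify : ∀ {n} x a → x < 6 → n ≡ 6 + (x + a * 6) → 3 ∣ n C 2 → AdmissibleOrder n
classify 0 a _ refl _ = 6+6r a
classify 1 a _ refl _ = 7+6r a
classify 2 a _ refl 3∣C = ⊥-elim (3∤choose-2 (2 + a * 2) (subst (λ n → 3 ∣ n C 2) (arithmetic a) 3∣C))
  where
  arithmetic : ∀ a → 6 + (2 + a * 6) ≡ 2 + (2 + a * 2) * 3
  arithmetic = solve-∀
classify 3 a _ refl _ = 9+6r a
classify 4 a _ refl _ = 10+6r a
classify 5 a _ refl 3∣C = ⊥-elim (3∤choose-2 (3 + a * 2) (subst (λ n → 3 ∣ n C 2) (arithmetic a) 3∣C))
  where
  arithmetic : ∀ a → 6 + (5 + a * 6) ≡ 2 + (3 + a * 2) * 3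
  arithmetic = solve-∀
classify (suc (suc (suc (suc (suc (suc _)))))) _ (s≤s (s≤s (s≤s (s≤s (s≤s (s≤s ())))))) _ _

admissible-order : ∀ {n} → Admissible n → AdmissibleOrder n
admissible-order {n} (6≤n , 3∣C) =
  classify (k % 6) (k / 6) (m%n<n k 6)
    (trans (sym (m+[n∸m]≡n 6≤n)) (cong (6 +_) (m≡m%n+[m/n]*n k 6))) 3∣C
  where
  k : ℕ
  k = n ∸ 6

corollary4p5 : ∀ (n : ℕ) → Admissible n →
    ∃[ S ] (BlockColourable {n} S (n ∸ 1) ⊎ BlockColourable {n} S n)
corollary4p5 n admissible with admissible-order admissible
... | 6+6r r  = let S , colouring = order-6+6r r  in S , inj₁ colouring
... | 7+6r r  = let S , colouring = order-7+6r r  in S , inj₂ colouring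
... | 9+6r r  = let S , colouring = order-9+6r r  in S , inj₁ colouring
... | 10+6r r = let S , colouring = order-10+6r r in S , inj₂ colouring
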